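{- Let $\mathbf{t}=T(\mathbf{f})$. Then for every $n\ge1$, the abelian complexity satisfies $\rho_{\mathbf{t}}(n)=3$.
   Context: Let $\varphi=(1+\sqrt5)/2$, $\alpha=2-\varphi$, and $\mathbf{f}=(\lfloor (n+1)\alpha\rfloor-\lfloor n\alpha\rfloor)_{n\ge1}=0100101\cdots$ (the Fibonacci word). $T$ keeps each $1$ and, among the occurrences of $0$ in order, replaces the 2nd, 4th, 6th, $\dots$ by $2$; so $\mathbf{t}=01201210210210120\cdots$. For a word $u$ over $\{0,1,2\}$ its Parikh vector is $\psi(u)=(|u|_0,|u|_1,|u|_2)$, and $\rho_{\mathbf{t}}(n)$ is the number of distinct Parikh vectors of length-$n$ factors of $\mathbf{t}$. -}

module Defs where

open import Data.Nat using (ℕ; zero; suc; _+_; _*_; _∸_; _≤ᵇ_; _≡ᵇ_)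
open import Data.Bool using (Bool; true; false; if_then_else_; _∧_)
open import Data.Product using (_×_; _,_)

-- α = 2 - φ = (3 - √5)/2.  For k ≥ 1 and n : ℕ,
--   k ≤ n α  ⇔  2k ≤ 3n - n√5  ⇔  2k ≤ 3n  ∧  5 n² ≤ (3n - 2k)².
-- (exact integer arithmetic; no reals needed)
leα : ℕ → ℕ → Bool
leα k n = ((2 * k) ≤ᵇ (3 * n)) ∧ ((5 * (n * n)) ≤ᵇ ((3 * n ∸ 2 * k) * (3 * n ∸ 2 * k)))

countLe : ℕ → ℕ → ℕ
countLe zero    n = 0
countLe (suc m) n = (if leα (suc m) n then 1 else 0) + countLe m n

-- ⌊ n α ⌋  (since 0 ≤ α < 1, ⌊nα⌋ ≤ n, and {k ≥ 1 : k ≤ nα} = {1,…,⌊nα⌋})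
floorα : ℕ → ℕ
floorα n = countLe n n

-- Fibonacci word, 0-indexed: fib i is the paper's f_{i+1}
--   = ⌊(i+2)α⌋ - ⌊(i+1)α⌋
fib : ℕ → ℕ
fib i = floorα (suc (suc i)) ∸ floorα (suc i)

zerosUpTo : ℕ → ℕ
zerosUpTo zero    = if fib 0 ≡ᵇ 0 then 1 else 0
zerosUpTo (suc i) = (if fib (suc i) ≡ᵇ 0 then 1 else 0) + zerosUpTo i

isEven : ℕ → Bool
isEven zero = true
isEven (suc zero) = false
isEven (suc (suc k)) = isEven k

-- t = T(f), 0-indexed: 1's are kept; the j-th 0 of f becomes 2 if j is even, else stays 0
tw : ℕ → ℕ
tw i = if fib i ≡ᵇ 0 then (if isEven (zerosUpTo i) then 2 else 0) else 1

occ : (ℕ → ℕ) → ℕ → ℕ → ℕ → ℕ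
occ w a i zero    = 0
occ w a i (suc n) = (if w i ≡ᵇ a then 1 else 0) + occ w a (suc i) n

parikh : (ℕ → ℕ) → ℕ → ℕ → ℕ × ℕ × ℕ
parikh w i n = (occ w 0 i n , occ w 1 i n , occ w 2 i n)

-- A factor of t is described, up to its Parikh vector, by its number o of 1s and the parity of
-- the number of 0s of f before it: from there on the 0s of f alternately become 0 and 2 in t.
-- Since f is balanced (⌊(m + n) α⌋ − ⌊m α⌋ − ⌊n α⌋ ∈ {0, 1}), o ∈ {⌊n α⌋, ⌊n α⌋ + 1}, so at most
-- four vectors arise, and the two parities give the same vector exactly when the number n − o
-- of 0s is even, which happens for exactly one value of o.  All four cases do occur: at a
-- position b − 1 with b = a + d for consecutive Fibonacci numbers d ≤ a, the number d / b
-- approximates α so well that the window of length n ≤ b / 6 contains exactly ⌊n α⌋ 1s when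
-- a² − a d − d² = 1, and ⌊n α⌋ + 1 when it is −1; such pairs exist, arbitrarily large, with a
-- of either parity.
module Submission where

open import Defs
open import Data.Bool using (Bool; true; false; if_then_else_; not; _∧_)
open import Data.Bool.Properties using (not-involutive)
open import Data.Empty using (⊥-elim)
open import Data.Nat using (ℕ; zero; suc; _+_; _*_; _∸_; _≤_; _<_; _≤ᵇ_; _≡ᵇ_; z≤n; s≤s; ⌊_/2⌋; ⌈_/2⌉; >-nonZero; s≤s⁻¹)
open import Data.Nat.Properties
open import Data.Nat.Divisibility using (_∣_; divides)
open import Data.Nat.Induction using (<-rec)
open import Data.Nat.Primality using (prime?; euclidsLemma)
open import Data.Nat.Tactic.RingSolver using (solve-∀)
open import Data.Product using (_×_; _,_; proj₁; proj₂; ∃-syntax)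
open import Data.Sum using (_⊎_; inj₁; inj₂)
open import Relation.Nullary using (¬_; yes; no)
open import Relation.Nullary.Decidable using (dec-true; dec-false; from-yes)
open import Relation.Binary.PropositionalEquality
  using (_≡_; _≢_; refl; sym; trans; cong; cong₂; subst; subst₂; module ≡-Reasoning)

square-mono-≤ : ∀ {x y} → x ≤ y → x * x ≤ y * y
square-mono-≤ p = *-mono-≤ p p

square-mono-< : ∀ {x y} → x < y → x * x < y * y
square-mono-< p = *-mono-< p p

square-cancel-≤ : ∀ {x y} → x * x ≤ y * y → x ≤ y
square-cancel-≤ p = ≮⇒≥ (λ y<x → <⇒≱ (square-mono-< y<x) p)

square-cancel-< : ∀ {x y} → x * x < y * y → x < y
square-cancel-< p = ≰⇒> (λ y≤x → <⇒≱ p (square-mono-≤ y≤x))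

m≤n≤1+m⇒n≡m∨n≡1+m : ∀ {m n} → m ≤ n → n ≤ suc m → n ≡ m ⊎ n ≡ suc m
m≤n≤1+m⇒n≡m∨n≡1+m m≤n n≤1+m with m≤n⇒m<n∨m≡n m≤n
... | inj₁ m<n = inj₂ (≤-antisym n≤1+m m<n)
... | inj₂ m≡n = inj₁ (sym m≡n)

m<n⇒n∸m≡1+[n∸1+m] : ∀ {m n} → m < n → n ∸ m ≡ suc (n ∸ suc m)
m<n⇒n∸m≡1+[n∸1+m] {zero}  {suc n} _         = refl
m<n⇒n∸m≡1+[n∸1+m] {suc m} {suc n} (s≤s m<n) = m<n⇒n∸m≡1+[n∸1+m] m<n

square-gap⇒2+≤ : ∀ {x y S T} → x * x + S ≤ y * y + T → T + 2 * x + 1 < S → 2 + x ≤ y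
square-gap⇒2+≤ {x} {y} {S} {T} le gap = ≰⇒> λ y≤1+x →
  <⇒≱ gap (+-cancelˡ-≤ (x * x) S (T + 2 * x + 1) (begin
    x * x + S               ≤⟨ le ⟩
    y * y + T               ≤⟨ +-monoˡ-≤ T (square-mono-≤ y≤1+x) ⟩
    suc x * suc x + T       ≡⟨ expand x T ⟩
    x * x + (T + 2 * x + 1) ∎))
  where
  open ≤-Reasoning
  expand : ∀ x T → suc x * suc x + T ≡ x * x + (T + 2 * x + 1)
  expand = solve-∀

square-gap⇒2+≤′ : ∀ {x y S T} → x * x + S ≤ y * y + T → 2 * y + T < S → 2 + x ≤ y
square-gap⇒2+≤′ {x} {y} {S} {T} le gap = square-gap⇒2+≤ le (≤-<-trans T+2x+1≤2y+T gap)
  where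
  x<y : x < y
  x<y = square-cancel-< (+-cancelʳ-< S (x * x) (y * y) (≤-<-trans le (+-monoʳ-< (y * y) (≤-<-trans (m≤n+m T (2 * y)) gap))))
  T+2x+1≤2y+T : T + 2 * x + 1 ≤ 2 * y + T
  T+2x+1≤2y+T = begin
    T + 2 * x + 1       ≤⟨ n≤1+n _ ⟩
    suc (T + 2 * x + 1) ≡⟨ regroup T x ⟩
    2 * suc x + T       ≤⟨ +-monoˡ-≤ T (*-monoʳ-≤ 2 x<y) ⟩
    2 * y + T           ∎
    where
    open ≤-Reasoning
    regroup : ∀ T x → suc (T + 2 * x + 1) ≡ 2 * suc x + T
    regroup = solve-∀

5·square-+-≥ : ∀ {a b X Y} → 5 * (a * a) ≤ X * X → 5 * (b * b) ≤ Y * Y →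
               5 * ((a + b) * (a + b)) ≤ (X + Y) * (X + Y)
5·square-+-≥ {a} {b} {X} {Y} p q = begin
  5 * ((a + b) * (a + b))                     ≡⟨ expand a b ⟩
  5 * (a * a) + 2 * (5 * a * b) + 5 * (b * b) ≤⟨ +-mono-≤ (+-mono-≤ p (*-monoʳ-≤ 2 5ab≤XY)) q ⟩
  X * X + 2 * (X * Y) + Y * Y                 ≡⟨ expand′ X Y ⟩
  (X + Y) * (X + Y)                           ∎
  where
  open ≤-Reasoning
  expand : ∀ a b → 5 * ((a + b) * (a + b)) ≡ 5 * (a * a) + 2 * (5 * a * b) + 5 * (b * b)
  expand = solve-∀
  expand′ : ∀ X Y → X * X + 2 * (X * Y) + Y * Y ≡ (X + Y) * (X + Y)
  expand′ = solve-∀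
  regroup : ∀ a b → (5 * a * b) * (5 * a * b) ≡ (5 * (a * a)) * (5 * (b * b))
  regroup = solve-∀
  regroup′ : ∀ X Y → (X * X) * (Y * Y) ≡ (X * Y) * (X * Y)
  regroup′ = solve-∀
  5ab≤XY : 5 * a * b ≤ X * Y
  5ab≤XY = square-cancel-≤ (subst₂ _≤_ (sym (regroup a b)) (regroup′ X Y) (*-mono-≤ p q))

5·square-+-< : ∀ {a b X Y} → X * X < 5 * (a * a) → Y * Y < 5 * (b * b) →
               (X + Y) * (X + Y) < 5 * ((a + b) * (a + b))
5·square-+-< {a} {b} {X} {Y} p q = begin-strict
  (X + Y) * (X + Y)                           ≡⟨ expand X Y ⟩
  X * X + 2 * (X * Y) + Y * Y                 <⟨ +-mono-<-≤ (+-mono-<-≤ p (*-monoʳ-≤ 2 (<⇒≤ XY<5ab))) (<⇒≤ q) ⟩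
  5 * (a * a) + 2 * (5 * a * b) + 5 * (b * b) ≡⟨ expand′ a b ⟩
  5 * ((a + b) * (a + b))                     ∎
  where
  open ≤-Reasoning
  expand : ∀ X Y → (X + Y) * (X + Y) ≡ X * X + 2 * (X * Y) + Y * Y
  expand = solve-∀
  expand′ : ∀ a b → 5 * (a * a) + 2 * (5 * a * b) + 5 * (b * b) ≡ 5 * ((a + b) * (a + b))
  expand′ = solve-∀
  regroup : ∀ X Y → (X * Y) * (X * Y) ≡ (X * X) * (Y * Y)
  regroup = solve-∀
  regroup′ : ∀ a b → (5 * (a * a)) * (5 * (b * b)) ≡ (5 * a * b) * (5 * a * b)
  regroup′ = solve-∀
  XY<5ab : X * Y < 5 * a * b
  XY<5ab = square-cancel-< (subst₂ _<_ (sym (regroup X Y)) (regroup′ a b) (*-mono-< p q))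

5·square+5≤ : ∀ {b n} → 1 ≤ n → 5 * (b * b) + 5 ≤ 5 * ((b + n) * (b + n))
5·square+5≤ {b} {n} 1≤n =
  subst (_≤ 5 * ((b + n) * (b + n))) (distrib (b * b)) (*-monoʳ-≤ 5 (square-mono-< (m<m+n b 1≤n)))
  where
  distrib : ∀ x → 5 * suc x ≡ 5 * x + 5
  distrib = solve-∀

5∣square⇒5∣ : ∀ {x} → 5 ∣ x * x → ∃[ q ] x ≡ q * 5
5∣square⇒5∣ {x} 5∣x² with euclidsLemma x x (from-yes (prime? 5)) 5∣x²
... | inj₁ (divides q eq) = q , eq
... | inj₂ (divides q eq) = q , eq

5·square-swap : ∀ a b → a * 5 * (a * 5) ≡ 5 * (b * b) → b * b ≡ 5 * (a * a)
5·square-swap a b eq = *-cancelˡ-≡ (b * b) (5 * (a * a)) 5 (trans (sym eq) (regroup a))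
  where
  regroup : ∀ a → a * 5 * (a * 5) ≡ 5 * (5 * (a * a))
  regroup = solve-∀

√5-irrational : ∀ n {Y} → 1 ≤ n → Y * Y ≢ 5 * (n * n)
√5-irrational = <-rec (λ n → ∀ {Y} → 1 ≤ n → Y * Y ≢ 5 * (n * n)) descent
  where
  descent : ∀ n → (∀ {m} → m < n → ∀ {Y} → 1 ≤ m → Y * Y ≢ 5 * (m * m)) →
            ∀ {Y} → 1 ≤ n → Y * Y ≢ 5 * (n * n)
  descent n rec {Y} 1≤n Y²≡5n² with 5∣square⇒5∣ {Y} (divides (n * n) (trans Y²≡5n² (*-comm 5 (n * n))))
  ... | q , refl with 5∣square⇒5∣ {n} (divides (q * q) (trans (5·square-swap q n Y²≡5n²) (*-comm 5 (q * q))))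
  ... | r , refl = rec r<n {q} 1≤r (5·square-swap r q (5·square-swap q (r * 5) Y²≡5n²))
    where
    positive : ∀ m → 1 ≤ m * 5 → 1 ≤ m
    positive (suc _) _ = s≤s z≤n
    1≤r : 1 ≤ r
    1≤r = positive r 1≤n
    r<n : r < r * 5
    r<n = m<m*n r 5 {{>-nonZero 1≤r}} (s≤s (s≤s z≤n))

-- The predicate k ≤ n α and the floor ⌊n α⌋

infix 4 _≤α_ _>α_

-- k ≤α n encodes k ≤ n α: with the slack X = 3n − 2k one has 2 (n α − k) = X − n √5.
record _≤α_ (k n : ℕ) : Set where
  constructor below
  field
    slack    : ℕ
    slack-eq : 3 * n ≡ 2 * k + slack
    slack-ge : 5 * (n * n) ≤ slack * slack

data _>α_ (k n : ℕ) : Set where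
  beyond-3/2 : 3 * n < 2 * k → k >α n
  small-slack : ∀ X → 3 * n ≡ 2 * k + X → X * X < 5 * (n * n) → k >α n

≤α-or->α : ∀ k n → k ≤α n ⊎ k >α n
≤α-or->α k n with 2 * k ≤? 3 * n
... | no 2k≰3n = inj₂ (beyond-3/2 (≰⇒> 2k≰3n))
... | yes 2k≤3n = by-slack (3 * n ∸ 2 * k) (sym (m+[n∸m]≡n 2k≤3n))
  where
  by-slack : ∀ X → 3 * n ≡ 2 * k + X → k ≤α n ⊎ k >α n
  by-slack X eq with 5 * (n * n) ≤? X * X
  ... | yes ge = inj₁ (below X eq ge)
  ... | no ≱ = inj₂ (small-slack X eq (≰⇒> ≱))

>α⇒≰α : ∀ {k n} → k >α n → ¬ k ≤α n
>α⇒≰α {k} (beyond-3/2 lt) (below X eq _) = <⇒≱ lt (subst (2 * k ≤_) (sym eq) (m≤m+n (2 * k) X))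
>α⇒≰α (small-slack Y eq′ lt) (below X eq ge) =
  <⇒≱ lt (subst (λ Z → _ ≤ Z * Z) (+-cancelˡ-≡ _ X Y (trans (sym eq) eq′)) ge)

≰α⇒>α : ∀ {k n} → ¬ k ≤α n → k >α n
≰α⇒>α {k} {n} k≰n with ≤α-or->α k n
... | inj₁ k≤n = ⊥-elim (k≰n k≤n)
... | inj₂ k>n = k>n

≤α-antimono : ∀ {j k n} → j ≤ k → k ≤α n → j ≤α n
≤α-antimono {j} {k} {n} j≤k (below X eq ge) =
  below (2 * (k ∸ j) + X) (trans eq (trans (cong (λ z → 2 * z + X) k≡j+d) (shift j (k ∸ j) X)))
        (≤-trans ge (square-mono-≤ (m≤n+m X (2 * (k ∸ j)))))
  where
  k≡j+d : k ≡ j + (k ∸ j)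
  k≡j+d = sym (m+[n∸m]≡n j≤k)
  shift : ∀ j d X → 2 * (j + d) + X ≡ 2 * j + (2 * d + X)
  shift = solve-∀

>α-mono : ∀ {j k n} → j ≤ k → j >α n → k >α n
>α-mono j≤k j>n = ≰α⇒>α (λ k≤n → >α⇒≰α j>n (≤α-antimono j≤k k≤n))

0≤α : ∀ n → 0 ≤α n
0≤α n = below (3 * n) refl (≤-trans (m≤m+n (5 * (n * n)) (4 * (n * n))) (≤-reflexive (nine n)))
  where
  nine : ∀ n → 5 * (n * n) + 4 * (n * n) ≡ 3 * n * (3 * n)
  nine = solve-∀

≥⇒>α : ∀ {k n} → 1 ≤ n → n ≤ k → k >α n
≥⇒>α {k} {n} 1≤n n≤k = ≰α⇒>α (λ k≤n → <⇒≱ (≤-<-trans (square-mono-≤ (slack≤n k≤n)) n²<5n²) (_≤α_.slack-ge k≤n))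
  where
  slack≤n : (k≤n : k ≤α n) → _≤α_.slack k≤n ≤ n
  slack≤n (below X eq _) = +-cancelˡ-≤ (2 * n) X n (begin
    2 * n + X ≤⟨ +-monoˡ-≤ X (*-monoʳ-≤ 2 n≤k) ⟩
    2 * k + X ≡⟨ sym eq ⟩
    3 * n     ≡⟨ split n ⟩
    2 * n + n ∎)
    where
    open ≤-Reasoning
    split : ∀ n → 3 * n ≡ 2 * n + n
    split = solve-∀
  n²<5n² : n * n < 5 * (n * n)
  n²<5n² = m<m+n (n * n) (*-mono-≤ {1} {4} (s≤s z≤n) (*-mono-≤ 1≤n 1≤n))

slack-eq-+ : ∀ {k l m n X Y} → 3 * m ≡ 2 * k + X → 3 * n ≡ 2 * l + Y →
             3 * (m + n) ≡ 2 * (k + l) + (X + Y)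
slack-eq-+ {k} {l} {m} {n} {X} {Y} eqX eqY =
  trans (distrib m n) (trans (cong₂ _+_ eqX eqY) (regroup k X l Y))
  where
  distrib : ∀ m n → 3 * (m + n) ≡ 3 * m + 3 * n
  distrib = solve-∀
  regroup : ∀ k X l Y → (2 * k + X) + (2 * l + Y) ≡ 2 * (k + l) + (X + Y)
  regroup = solve-∀

≤α-+ : ∀ {k l m n} → k ≤α m → l ≤α n → k + l ≤α m + n
≤α-+ {k} {l} {m} {n} (below X eqX geX) (below Y eqY geY) =
  below (X + Y) (slack-eq-+ {k} {l} {m} {n} eqX eqY) (5·square-+-≥ {m} {n} {X} {Y} geX geY)

slack-shrinks : ∀ {k l m n Y W} → 3 * m < 2 * k → 3 * n ≡ 2 * l + Y → 3 * (m + n) ≡ 2 * (k + l) + W → W < Y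
slack-shrinks {k} {l} {m} {n} {Y} {W} lt eqY eqW = +-cancelˡ-< (3 * m + 2 * l) W Y (begin-strict
  3 * m + 2 * l + W   ≡⟨ +-assoc (3 * m) (2 * l) W ⟩
  3 * m + (2 * l + W) <⟨ +-monoˡ-< (2 * l + W) lt ⟩
  2 * k + (2 * l + W) ≡⟨ regroup k l W ⟩
  2 * (k + l) + W     ≡⟨ eqW ⟨
  3 * (m + n)         ≡⟨ trans (*-distribˡ-+ 3 m n) (cong (3 * m +_) eqY) ⟩
  3 * m + (2 * l + Y) ≡⟨ +-assoc (3 * m) (2 * l) Y ⟨
  3 * m + 2 * l + Y   ∎)
  where
  open ≤-Reasoning
  regroup : ∀ k l W → 2 * k + (2 * l + W) ≡ 2 * (k + l) + W
  regroup = solve-∀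

beyond+small⇒>α : ∀ {k l m n Y} → 3 * m < 2 * k → 3 * n ≡ 2 * l + Y → Y * Y < 5 * (n * n) →
                  k + l >α m + n
beyond+small⇒>α {k} {l} {m} {n} {Y} lt eqY ltY = ≰α⇒>α sum≰α
  where
  open ≤-Reasoning
  sum≰α : ¬ k + l ≤α m + n
  sum≰α (below W eqW geW) = <⇒≱ (begin-strict
    W * W                   <⟨ square-mono-< (slack-shrinks {k} {l} {m} {n} lt eqY eqW) ⟩
    Y * Y                   <⟨ ltY ⟩
    5 * (n * n)             ≤⟨ *-monoʳ-≤ 5 (square-mono-≤ (m≤n+m n m)) ⟩
    5 * ((m + n) * (m + n)) ∎) geW

>α-+ : ∀ {k l m n} → k >α m → l >α n → k + l >α m + n
>α-+ {k} {l} {m} {n} (beyond-3/2 p) (beyond-3/2 q) =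
  beyond-3/2 (subst₂ _<_ (sym (*-distribˡ-+ 3 m n)) (sym (*-distribˡ-+ 2 k l)) (+-mono-< p q))
>α-+ {k} {l} {m} {n} (beyond-3/2 p) (small-slack Y eqY ltY) = beyond+small⇒>α {k} {l} {m} {n} p eqY ltY
>α-+ {k} {l} {m} {n} (small-slack X eqX ltX) (beyond-3/2 q) =
  subst₂ _>α_ (+-comm l k) (+-comm n m) (beyond+small⇒>α {l} {k} {n} {m} q eqX ltX)
>α-+ {k} {l} {m} {n} (small-slack X eqX ltX) (small-slack Y eqY ltY) =
  small-slack (X + Y) (slack-eq-+ {k} {l} {m} {n} eqX eqY) (5·square-+-< {m} {n} {X} {Y} ltX ltY)

slack-eq⇒≤ : ∀ {k n X} → 3 * n ≡ 2 * k + X → 2 * k ≤ 3 * n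
slack-eq⇒≤ {k} {n} {X} eq = subst (2 * k ≤_) (sym eq) (m≤m+n (2 * k) X)

slack-eq⇒∸ : ∀ {k n X} → 3 * n ≡ 2 * k + X → 3 * n ∸ 2 * k ≡ X
slack-eq⇒∸ {k} {n} {X} eq = trans (cong (_∸ 2 * k) eq) (m+n∸m≡n (2 * k) X)

≤ᵇ-true : ∀ {m n} → m ≤ n → (m ≤ᵇ n) ≡ true
≤ᵇ-true {m} {n} = dec-true (m ≤? n)

≤ᵇ-false : ∀ {m n} → n < m → (m ≤ᵇ n) ≡ false
≤ᵇ-false {m} {n} n<m = dec-false (m ≤? n) (<⇒≱ n<m)

leα-true : ∀ {k n} → k ≤α n → leα k n ≡ true
leα-true {k} {n} (below X eq ge) =
  cong₂ _∧_ (≤ᵇ-true (slack-eq⇒≤ {k} {n} {X} eq))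
            (≤ᵇ-true {5 * (n * n)} (subst (λ Z → 5 * (n * n) ≤ Z * Z) (sym (slack-eq⇒∸ {k} {n} {X} eq)) ge))

leα-false : ∀ {k n} → k >α n → leα k n ≡ false
leα-false {k} {n} (beyond-3/2 lt) = cong (_∧ (5 * (n * n) ≤ᵇ (3 * n ∸ 2 * k) * (3 * n ∸ 2 * k))) (≤ᵇ-false lt)
leα-false {k} {n} (small-slack X eq lt) =
  cong₂ _∧_ (≤ᵇ-true (slack-eq⇒≤ {k} {n} {X} eq))
            (≤ᵇ-false {5 * (n * n)} (subst (λ Z → Z * Z < 5 * (n * n)) (sym (slack-eq⇒∸ {k} {n} {X} eq)) lt))

countLe-≤ : ∀ m n → countLe m n ≤ m
countLe-≤ zero    n = z≤n
countLe-≤ (suc m) n with leα (suc m) n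
... | true  = s≤s (countLe-≤ m n)
... | false = m≤n⇒m≤1+n (countLe-≤ m n)

countLe-spec : ∀ m n → countLe m n ≤α n × (countLe m n ≡ m ⊎ suc (countLe m n) >α n)
countLe-spec zero    n = 0≤α n , inj₁ refl
countLe-spec (suc m) n with ≤α-or->α (suc m) n | countLe-spec m n
... | inj₁ m+1≤n | _ , inj₁ c≡m rewrite leα-true m+1≤n | c≡m = m+1≤n , inj₁ refl
... | inj₁ m+1≤n | _ , inj₂ c+1>n =
  ⊥-elim (>α⇒≰α (>α-mono (s≤s (countLe-≤ m n)) c+1>n) m+1≤n)
... | inj₂ m+1>n | c≤n , inj₁ c≡m rewrite leα-false m+1>n | c≡m = c≤n , inj₂ m+1>n
... | inj₂ m+1>n | c≤n , inj₂ c+1>n rewrite leα-false m+1>n = c≤n , inj₂ c+1>n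

1+n>αn : ∀ n → suc n >α n
1+n>αn zero    = beyond-3/2 (s≤s z≤n)
1+n>αn (suc n) = ≥⇒>α (s≤s z≤n) (n≤1+n (suc n))

floorα-spec : ∀ n → floorα n ≤α n × suc (floorα n) >α n
floorα-spec n with countLe-spec n n
... | le , inj₁ eq = le , subst (λ c → suc c >α n) (sym eq) (1+n>αn n)
... | le , inj₂ gt = le , gt

floorα-≤α : ∀ n → floorα n ≤α n
floorα-≤α n = proj₁ (floorα-spec n)

suc-floorα->α : ∀ n → suc (floorα n) >α n
suc-floorα->α n = proj₂ (floorα-spec n)

≤α⇒≤floorα : ∀ {k n} → k ≤α n → k ≤ floorα n
≤α⇒≤floorα {n = n} k≤n = ≮⇒≥ (λ fl<k → >α⇒≰α (>α-mono fl<k (suc-floorα->α n)) k≤n)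

>α⇒floorα< : ∀ {k n} → k >α n → floorα n < k
>α⇒floorα< {n = n} k>n = ≰⇒> (λ k≤fl → >α⇒≰α k>n (≤α-antimono k≤fl (floorα-≤α n)))

floorα-unique : ∀ {k n} → k ≤α n → suc k >α n → floorα n ≡ k
floorα-unique le gt = ≤-antisym (s≤s⁻¹ (>α⇒floorα< gt)) (≤α⇒≤floorα le)

floorα-superadditive : ∀ m n → floorα m + floorα n ≤ floorα (m + n)
floorα-superadditive m n = ≤α⇒≤floorα (≤α-+ (floorα-≤α m) (floorα-≤α n))

floorα-+-≤ : ∀ m n → floorα (m + n) ≤ suc (floorα m + floorα n)
floorα-+-≤ m n = s≤s⁻¹ (>α⇒floorα<
  (subst (_>α m + n) (cong suc (+-suc (floorα m) (floorα n))) (>α-+ (suc-floorα->α m) (suc-floorα->α n))))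

floorα-step : ∀ n → floorα (suc n) ≡ floorα n ⊎ floorα (suc n) ≡ suc (floorα n)
floorα-step n = m≤n≤1+m⇒n≡m∨n≡1+m (floorα-superadditive 1 n) (floorα-+-≤ 1 n)

-- The Fibonacci word

data FibLetter (i : ℕ) : Set where
  letter-0 : fib i ≡ 0 → floorα (2 + i) ≡ floorα (1 + i) → FibLetter i
  letter-1 : fib i ≡ 1 → floorα (2 + i) ≡ suc (floorα (1 + i)) → FibLetter i

fib-letter : ∀ i → FibLetter i
fib-letter i = from-step (floorα-step (suc i))
  where
  from-step : floorα (2 + i) ≡ floorα (1 + i) ⊎ floorα (2 + i) ≡ suc (floorα (1 + i)) → FibLetter i
  from-step (inj₁ eq) = letter-0 (trans (cong (_∸ floorα (1 + i)) eq) (n∸n≡0 (floorα (1 + i)))) eq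
  from-step (inj₂ eq) = letter-1 (trans (cong (_∸ floorα (1 + i)) eq) (m+n∸n≡m 1 (floorα (1 + i)))) eq

occ-suc : ∀ (w : ℕ → ℕ) a i n {b} → w i ≡ b →
          occ w a i (suc n) ≡ (if b ≡ᵇ a then 1 else 0) + occ w a (suc i) n
occ-suc w a i n eq = cong (λ x → (if x ≡ᵇ a then 1 else 0) + occ w a (suc i) n) eq

ones-fib : ∀ n i → occ fib 1 i n + floorα (suc i) ≡ floorα (suc i + n)
ones-fib zero    i = cong floorα (sym (+-identityʳ (suc i)))
ones-fib (suc n) i = by-letter (fib-letter i)
  where
  open ≡-Reasoning
  next : occ fib 1 (suc i) n + floorα (2 + i) ≡ floorα (suc i + suc n)
  next = trans (ones-fib n (suc i)) (cong (λ m → floorα (suc m)) (sym (+-suc i n)))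
  by-letter : FibLetter i → occ fib 1 i (suc n) + floorα (suc i) ≡ floorα (suc i + suc n)
  by-letter (letter-0 f0 eq) = begin
    occ fib 1 i (suc n) + floorα (suc i)   ≡⟨ cong (_+ floorα (suc i)) (occ-suc fib 1 i n f0) ⟩
    occ fib 1 (suc i) n + floorα (suc i)   ≡⟨ cong (occ fib 1 (suc i) n +_) eq ⟨
    occ fib 1 (suc i) n + floorα (2 + i)   ≡⟨ next ⟩
    floorα (suc i + suc n)                 ∎
  by-letter (letter-1 f1 eq) = begin
    occ fib 1 i (suc n) + floorα (suc i)         ≡⟨ cong (_+ floorα (suc i)) (occ-suc fib 1 i n f1) ⟩
    suc (occ fib 1 (suc i) n) + floorα (suc i)   ≡⟨ +-suc (occ fib 1 (suc i) n) (floorα (suc i)) ⟨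
    occ fib 1 (suc i) n + suc (floorα (suc i))   ≡⟨ cong (occ fib 1 (suc i) n +_) eq ⟨
    occ fib 1 (suc i) n + floorα (2 + i)         ≡⟨ next ⟩
    floorα (suc i + suc n)                       ∎

zeros+ones-fib : ∀ n i → occ fib 0 i n + occ fib 1 i n ≡ n
zeros+ones-fib zero    i = refl
zeros+ones-fib (suc n) i = by-letter (fib-letter i)
  where
  by-letter : FibLetter i → occ fib 0 i (suc n) + occ fib 1 i (suc n) ≡ suc n
  by-letter (letter-0 f0 _) =
    trans (cong₂ _+_ (occ-suc fib 0 i n f0) (occ-suc fib 1 i n f0)) (cong suc (zeros+ones-fib n (suc i)))
  by-letter (letter-1 f1 _) =
    trans (cong₂ _+_ (occ-suc fib 0 i n f1) (occ-suc fib 1 i n f1))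
          (trans (+-suc _ _) (cong suc (zeros+ones-fib n (suc i))))

zerosBefore : ℕ → ℕ
zerosBefore zero    = 0
zerosBefore (suc i) = zerosUpTo i

zerosBefore-suc : ∀ i {b} → fib i ≡ b → zerosBefore (suc i) ≡ (if b ≡ᵇ 0 then 1 else 0) + zerosBefore i
zerosBefore-suc zero    eq = trans (cong (λ x → if x ≡ᵇ 0 then 1 else 0) eq) (sym (+-identityʳ _))
zerosBefore-suc (suc i) eq = cong (λ x → (if x ≡ᵇ 0 then 1 else 0) + zerosUpTo i) eq

zerosBefore+floorα : ∀ i → zerosBefore i + floorα (suc i) ≡ i
zerosBefore+floorα zero    = refl
zerosBefore+floorα (suc i) = by-letter (fib-letter i)
  where
  by-letter : FibLetter i → zerosBefore (suc i) + floorα (2 + i) ≡ suc i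
  by-letter (letter-0 f0 eq) =
    trans (cong₂ _+_ (zerosBefore-suc i f0) eq) (cong suc (zerosBefore+floorα i))
  by-letter (letter-1 f1 eq) =
    trans (cong₂ _+_ (zerosBefore-suc i f1) eq) (trans (+-suc _ _) (cong suc (zerosBefore+floorα i)))

ones-fib-window : ∀ n i → occ fib 1 i n ≡ floorα n ⊎ occ fib 1 i n ≡ suc (floorα n)
ones-fib-window n i = m≤n≤1+m⇒n≡m∨n≡1+m lower upper
  where
  lower : floorα n ≤ occ fib 1 i n
  lower = +-cancelʳ-≤ (floorα (suc i)) (floorα n) (occ fib 1 i n)
    (subst₂ _≤_ (+-comm (floorα (suc i)) (floorα n)) (sym (ones-fib n i)) (floorα-superadditive (suc i) n))
  upper : occ fib 1 i n ≤ suc (floorα n)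
  upper = +-cancelʳ-≤ (floorα (suc i)) (occ fib 1 i n) (suc (floorα n))
    (subst₂ _≤_ (sym (ones-fib n i)) (cong suc (+-comm (floorα (suc i)) (floorα n))) (floorα-+-≤ (suc i) n))

ones-fib-from-floors : ∀ {n i k m} → floorα (suc i) ≡ k → floorα (suc i + n) ≡ k + m → occ fib 1 i n ≡ m
ones-fib-from-floors {n} {i} {k} {m} eq eq′ =
  +-cancelʳ-≡ k (occ fib 1 i n) m (trans (subst (λ x → occ fib 1 i n + x ≡ floorα (suc i + n)) eq (ones-fib n i))
                                         (trans eq′ (+-comm k m)))

zerosBefore-from-floor : ∀ {i k} → floorα (suc i) ≡ k → zerosBefore i + k ≡ i
zerosBefore-from-floor {i} eq = subst (λ x → zerosBefore i + x ≡ i) eq (zerosBefore+floorα i)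

-- The word t

isEven-suc : ∀ x → isEven (suc x) ≡ not (isEven x)
isEven-suc zero          = refl
isEven-suc (suc zero)    = refl
isEven-suc (suc (suc x)) = isEven-suc x

-- The letter of t at a 0 of f preceded by j zeros of f.
zeroLetter : ℕ → ℕ
zeroLetter j = if isEven (suc j) then 2 else 0

tw-at-0 : ∀ {i} → fib i ≡ 0 → tw i ≡ zeroLetter (zerosBefore i)
tw-at-0 {i} f0 = trans (cong (λ x → if x ≡ᵇ 0 then (if isEven (zerosUpTo i) then 2 else 0) else 1) f0)
                       (cong (λ z → if isEven z then 2 else 0) (zerosBefore-suc i f0))

tw-at-1 : ∀ {i} → fib i ≡ 1 → tw i ≡ 1
tw-at-1 {i} f1 = cong (λ x → if x ≡ᵇ 0 then (if isEven (zerosUpTo i) then 2 else 0) else 1) f1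

occ-tw : ∀ a n i → occ tw a i n ≡
         occ zeroLetter a (zerosBefore i) (occ fib 0 i n) + (if 1 ≡ᵇ a then 1 else 0) * occ fib 1 i n
occ-tw a zero    i = sym (*-zeroʳ (if 1 ≡ᵇ a then 1 else 0))
occ-tw a (suc n) i = by-letter (fib-letter i)
  where
  open ≡-Reasoning
  δ j z o : ℕ
  δ = if 1 ≡ᵇ a then 1 else 0
  j = zerosBefore i
  z = occ fib 0 (suc i) n
  o = occ fib 1 (suc i) n
  counts : ℕ → ℕ → ℕ → ℕ
  counts j′ z′ o′ = occ zeroLetter a j′ z′ + δ * o′
  rest : ∀ {b} → fib i ≡ b → occ tw a (suc i) n ≡ counts ((if b ≡ᵇ 0 then 1 else 0) + j) z o
  rest f = trans (occ-tw a n (suc i)) (cong (λ j′ → counts j′ z o) (zerosBefore-suc i f))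
  here : ∀ {b} → fib i ≡ b → counts j (occ fib 0 i (suc n)) (occ fib 1 i (suc n)) ≡
                             counts j ((if b ≡ᵇ 0 then 1 else 0) + z) ((if b ≡ᵇ 1 then 1 else 0) + o)
  here f = cong₂ (counts j) (occ-suc fib 0 i n f) (occ-suc fib 1 i n f)
  by-letter : FibLetter i → occ tw a i (suc n) ≡ counts j (occ fib 0 i (suc n)) (occ fib 1 i (suc n))
  by-letter (letter-0 f0 _) = begin
    occ tw a i (suc n)                       ≡⟨ occ-suc tw a i n (tw-at-0 {i} f0) ⟩
    ε + occ tw a (suc i) n                   ≡⟨ cong (ε +_) (rest f0) ⟩
    ε + (occ zeroLetter a (suc j) z + δ * o) ≡⟨ +-assoc ε (occ zeroLetter a (suc j) z) (δ * o) ⟨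
    counts j (suc z) o                       ≡⟨ here f0 ⟨
    counts j (occ fib 0 i (suc n)) (occ fib 1 i (suc n)) ∎
    where
    ε : ℕ
    ε = if zeroLetter j ≡ᵇ a then 1 else 0
  by-letter (letter-1 f1 _) = begin
    occ tw a i (suc n)     ≡⟨ occ-suc tw a i n (tw-at-1 {i} f1) ⟩
    δ + occ tw a (suc i) n ≡⟨ cong (δ +_) (rest f1) ⟩
    δ + counts j z o       ≡⟨ regroup δ (occ zeroLetter a j z) o ⟩
    counts j z (suc o)     ≡⟨ here f1 ⟨
    counts j (occ fib 0 i (suc n)) (occ fib 1 i (suc n)) ∎
    where
    regroup : ∀ δ Z o → δ + (Z + δ * o) ≡ Z + δ * suc o
    regroup = solve-∀

zeroLetter-periodic : ∀ a j z → occ zeroLetter a (2 + j) z ≡ occ zeroLetter a j z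
zeroLetter-periodic a j zero    = refl
zeroLetter-periodic a j (suc z) =
  cong ((if zeroLetter j ≡ᵇ a then 1 else 0) +_) (zeroLetter-periodic a (suc j) z)

occ-zeroLetter-parity : ∀ a j z → occ zeroLetter a j z ≡ occ zeroLetter a (if isEven j then 0 else 1) z
occ-zeroLetter-parity a zero          z = refl
occ-zeroLetter-parity a (suc zero)    z = refl
occ-zeroLetter-parity a (suc (suc j)) z = trans (zeroLetter-periodic a j z) (occ-zeroLetter-parity a j z)

occ-zeroLetter-1 : ∀ j z → occ zeroLetter 1 j z ≡ 0
occ-zeroLetter-1 j zero = refl
occ-zeroLetter-1 j (suc z) with isEven (suc j)
... | true  = occ-zeroLetter-1 (suc j) z
... | false = occ-zeroLetter-1 (suc j) z

occ-zeroLetter-0 : ∀ z → occ zeroLetter 0 0 z ≡ ⌈ z /2⌉ × occ zeroLetter 0 1 z ≡ ⌊ z /2⌋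
occ-zeroLetter-0 zero    = refl , refl
occ-zeroLetter-0 (suc z) = cong suc (proj₂ IH) , trans (zeroLetter-periodic 0 0 z) (proj₁ IH)
  where
  IH : occ zeroLetter 0 0 z ≡ ⌈ z /2⌉ × occ zeroLetter 0 1 z ≡ ⌊ z /2⌋
  IH = occ-zeroLetter-0 z

occ-zeroLetter-2 : ∀ z → occ zeroLetter 2 0 z ≡ ⌊ z /2⌋ × occ zeroLetter 2 1 z ≡ ⌈ z /2⌉
occ-zeroLetter-2 zero    = refl , refl
occ-zeroLetter-2 (suc z) = proj₂ IH , cong suc (trans (zeroLetter-periodic 2 0 z) (proj₁ IH))
  where
  IH : occ zeroLetter 2 0 z ≡ ⌊ z /2⌋ × occ zeroLetter 2 1 z ≡ ⌈ z /2⌉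
  IH = occ-zeroLetter-2 z

-- The Parikh vector of a factor of t with o ones and z zeros of f, the first of which
-- is preceded by an even (true) or odd (false) number of zeros of f.
parikhT : Bool → ℕ → ℕ → ℕ × ℕ × ℕ
parikhT true  o z = (⌈ z /2⌉ , o , ⌊ z /2⌋)
parikhT false o z = (⌊ z /2⌋ , o , ⌈ z /2⌉)

⌈n/2⌉≡⌊n/2⌋ : ∀ z → isEven z ≡ true → ⌈ z /2⌉ ≡ ⌊ z /2⌋
⌈n/2⌉≡⌊n/2⌋ zero          _    = refl
⌈n/2⌉≡⌊n/2⌋ (suc (suc z)) even = cong suc (⌈n/2⌉≡⌊n/2⌋ z even)

⌈n/2⌉≡1+⌊n/2⌋ : ∀ z → isEven z ≡ false → ⌈ z /2⌉ ≡ suc ⌊ z /2⌋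
⌈n/2⌉≡1+⌊n/2⌋ (suc zero)    _   = refl
⌈n/2⌉≡1+⌊n/2⌋ (suc (suc z)) odd = cong suc (⌈n/2⌉≡1+⌊n/2⌋ z odd)

parikhT-collapse : ∀ o z → isEven z ≡ true → parikhT true o z ≡ parikhT false o z
parikhT-collapse o z even = cong₂ (λ x y → (x , o , y)) (⌈n/2⌉≡⌊n/2⌋ z even) (sym (⌈n/2⌉≡⌊n/2⌋ z even))

parikhT-split : ∀ o z → isEven z ≡ false → parikhT true o z ≢ parikhT false o z
parikhT-split o z odd eq = 1+n≢n (trans (sym (⌈n/2⌉≡1+⌊n/2⌋ z odd)) (cong proj₁ eq))

parikhT-ones : ∀ e o z → proj₁ (proj₂ (parikhT e o z)) ≡ o
parikhT-ones true  o z = refl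
parikhT-ones false o z = refl

parikhT-≢-suc : ∀ e e′ o z z′ → parikhT e o z ≢ parikhT e′ (suc o) z′
parikhT-≢-suc e e′ o z z′ eq =
  1+n≢n (sym (trans (sym (parikhT-ones e o z)) (trans (cong (λ v → proj₁ (proj₂ v)) eq) (parikhT-ones e′ (suc o) z′))))

zeroLetter-parikh : ∀ j o z → (occ zeroLetter 0 j z , o , occ zeroLetter 2 j z) ≡ parikhT (isEven j) o z
zeroLetter-parikh j o z
  rewrite occ-zeroLetter-parity 0 j z | occ-zeroLetter-parity 2 j z with isEven j
... | true  = cong₂ (λ x y → (x , o , y)) (proj₁ (occ-zeroLetter-0 z)) (proj₁ (occ-zeroLetter-2 z))
... | false = cong₂ (λ x y → (x , o , y)) (proj₂ (occ-zeroLetter-0 z)) (proj₂ (occ-zeroLetter-2 z))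

parikh-tw : ∀ n i → parikh tw i n ≡ parikhT (isEven (zerosBefore i)) (occ fib 1 i n) (n ∸ occ fib 1 i n)
parikh-tw n i = begin
  (occ tw 0 i n , occ tw 1 i n , occ tw 2 i n)
    ≡⟨ cong₂ (λ x y → (x , y , occ tw 2 i n)) (trans (occ-tw 0 n i) (+-identityʳ _)) (occ-tw 1 n i) ⟩
  (occ zeroLetter 0 j z , occ zeroLetter 1 j z + 1 * o , occ tw 2 i n)
    ≡⟨ cong₂ (λ x y → (occ zeroLetter 0 j z , x , y))
             (trans (cong (_+ 1 * o) (occ-zeroLetter-1 j z)) (*-identityˡ o))
             (trans (occ-tw 2 n i) (+-identityʳ _)) ⟩
  (occ zeroLetter 0 j z , o , occ zeroLetter 2 j z)
    ≡⟨ zeroLetter-parikh j o z ⟩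
  parikhT (isEven j) o z
    ≡⟨ cong (parikhT (isEven j) o) zeros≡ ⟩
  parikhT (isEven j) o (n ∸ o) ∎
  where
  open ≡-Reasoning
  j o z : ℕ
  j = zerosBefore i
  o = occ fib 1 i n
  z = occ fib 0 i n
  zeros≡ : z ≡ n ∸ o
  zeros≡ = trans (sym (m+n∸n≡m z o)) (cong (_∸ o) (zeros+ones-fib n i))

-- Fibonacci numbers as best approximations of α

-- a² − a d − d² = t − s, the norm of a − d φ in ℤ[φ].
NormEq : ℕ → ℕ → ℕ → ℕ → Set
NormEq s t a d = a * a + s ≡ a * d + d * d + t

-- Here 0 < b α − d < 1 / (√5 b): too little to push the fractional part of n α past 1 when n ≤ b / 6.
module PlusSolution {a d : ℕ} (norm : NormEq 0 1 (suc a) d) where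

  b X : ℕ
  b = suc a + d
  X = 3 * suc a + d

  3b≡2d+X : 3 * b ≡ 2 * d + X
  3b≡2d+X = split a d
    where
    split : ∀ a d → 3 * (suc a + d) ≡ 2 * d + (3 * suc a + d)
    split = solve-∀

  X²≡5b²+4 : X * X ≡ 5 * (b * b) + 4
  X²≡5b²+4 = +-cancelʳ-≡ (4 * (suc a * d + d * d + 1)) (X * X) (5 * (b * b) + 4)
    (trans (identity a d) (cong (λ t → 5 * (b * b) + 4 + 4 * t) norm))
    where
    identity : ∀ a d → (3 * suc a + d) * (3 * suc a + d) + 4 * (suc a * d + d * d + 1) ≡
                       5 * ((suc a + d) * (suc a + d)) + 4 + 4 * (suc a * suc a + 0)
    identity = solve-∀

  d≤αb : d ≤α b
  d≤αb = below X 3b≡2d+X (subst (5 * (b * b) ≤_) (sym X²≡5b²+4) (m≤m+n (5 * (b * b)) 4))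

  1+d>αb : suc d >α b
  1+d>αb = small-slack W (split a d) (subst (W * W <_) (sym 5b²≡W²+4W) (m<m+n (W * W) (s≤s z≤n)))
    where
    W : ℕ
    W = suc (3 * a + d)
    split : ∀ a d → 3 * (suc a + d) ≡ 2 * suc d + suc (3 * a + d)
    split = solve-∀
    expand : ∀ a d → (3 * suc a + d) * (3 * suc a + d) ≡ suc (3 * a + d) * suc (3 * a + d) + 4 * suc (3 * a + d) + 4
    expand = solve-∀
    5b²≡W²+4W : 5 * (b * b) ≡ W * W + 4 * W
    5b²≡W²+4W = +-cancelʳ-≡ 4 (5 * (b * b)) (W * W + 4 * W) (trans (sym X²≡5b²+4) (expand a d))

  floorα-b : floorα b ≡ d
  floorα-b = floorα-unique d≤αb 1+d>αb

  module _ {n : ℕ} (1≤n : 1 ≤ n) (6n≤b : 6 * n ≤ b) where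

    n≤b : n ≤ b
    n≤b = ≤-trans (m≤n*m n 6) 6n≤b

    beyond-case : ∀ {c} → 3 * n < 2 * suc c → suc (d + c) >α b + n
    beyond-case {c} lt = ≰α⇒>α λ { (below W eqW geW) → <⇒≱ (begin-strict
      W * W                   <⟨ square-mono-< (W<X W eqW) ⟩
      X * X                   ≡⟨ X²≡5b²+4 ⟩
      5 * (b * b) + 4         <⟨ +-monoʳ-< (5 * (b * b)) (n<1+n 4) ⟩
      5 * (b * b) + 5         ≤⟨ 5·square+5≤ {b} 1≤n ⟩
      5 * ((b + n) * (b + n)) ∎) geW }
      where
      open ≤-Reasoning
      W<X : ∀ W → 3 * (b + n) ≡ 2 * suc (d + c) + W → W < X
      W<X W eqW = slack-shrinks {suc c} {d} {n} {b} lt 3b≡2d+X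
        (trans (cong (3 *_) (+-comm n b)) (trans eqW (cong (λ t → 2 * suc t + W) (+-comm d c))))

    M : ℕ
    M = 5 * b * n

    gap : 2 * M + 20 * (n * n) < X * X
    gap = begin-strict
      2 * M + 20 * (n * n) ≤⟨ +-monoʳ-≤ (2 * M) (*-monoʳ-≤ 20 (*-monoˡ-≤ n n≤b)) ⟩
      2 * M + 20 * (b * n) ≡⟨ regroup b n ⟩
      5 * (b * (6 * n))    ≤⟨ *-monoʳ-≤ 5 (*-monoʳ-≤ b 6n≤b) ⟩
      5 * (b * b)          <⟨ m<m+n (5 * (b * b)) (s≤s z≤n) ⟩
      5 * (b * b) + 4      ≡⟨ X²≡5b²+4 ⟨
      X * X                ∎
      where
      open ≤-Reasoning
      regroup : ∀ b n → 2 * (5 * b * n) + 20 * (b * n) ≡ 5 * (b * (6 * n))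
      regroup = solve-∀

    module _ {Y : ℕ} (Y²<5n² : Y * Y < 5 * (n * n)) where

      P : ℕ
      P = X * Y

      2+P≤M : 2 + P ≤ M
      2+P≤M = square-gap⇒2+≤′ {P} {M} (begin
        P * P + X * X                     ≡⟨ factor X Y ⟩
        X * X * (1 + Y * Y)               ≤⟨ *-monoʳ-≤ (X * X) Y²<5n² ⟩
        X * X * (5 * (n * n))             ≡⟨ cong (_* (5 * (n * n))) X²≡5b²+4 ⟩
        (5 * (b * b) + 4) * (5 * (n * n)) ≡⟨ expand b n ⟩
        M * M + 20 * (n * n)              ∎) gap
        where
        open ≤-Reasoning
        factor : ∀ X Y → X * Y * (X * Y) + X * X ≡ X * X * (1 + Y * Y)
        factor = solve-∀
        expand : ∀ b n → (5 * (b * b) + 4) * (5 * (n * n)) ≡ 5 * b * n * (5 * b * n) + 20 * (n * n)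
        expand = solve-∀

      [X+Y]²<5[b+n]² : (X + Y) * (X + Y) < 5 * ((b + n) * (b + n))
      [X+Y]²<5[b+n]² = begin-strict
        (X + Y) * (X + Y)                       <⟨ n<1+n _ ⟩
        suc ((X + Y) * (X + Y))                 ≡⟨ expand X Y ⟩
        X * X + 2 * P + (1 + Y * Y)             ≤⟨ +-monoʳ-≤ (X * X + 2 * P) Y²<5n² ⟩
        X * X + 2 * P + 5 * (n * n)             ≡⟨ cong (λ t → t + 2 * P + 5 * (n * n)) X²≡5b²+4 ⟩
        5 * (b * b) + 4 + 2 * P + 5 * (n * n)   ≡⟨ regroup (b * b) P (n * n) ⟩
        5 * (b * b) + 2 * (2 + P) + 5 * (n * n) ≤⟨ +-monoˡ-≤ (5 * (n * n)) (+-monoʳ-≤ (5 * (b * b)) (*-monoʳ-≤ 2 2+P≤M)) ⟩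
        5 * (b * b) + 2 * M + 5 * (n * n)       ≡⟨ expand′ b n ⟩
        5 * ((b + n) * (b + n))                 ∎
        where
        open ≤-Reasoning
        expand : ∀ X Y → suc ((X + Y) * (X + Y)) ≡ X * X + 2 * (X * Y) + (1 + Y * Y)
        expand = solve-∀
        regroup : ∀ B P N → 5 * B + 4 + 2 * P + 5 * N ≡ 5 * B + 2 * (2 + P) + 5 * N
        regroup = solve-∀
        expand′ : ∀ b n → 5 * (b * b) + 2 * (5 * b * n) + 5 * (n * n) ≡ 5 * ((b + n) * (b + n))
        expand′ = solve-∀

    small-case : ∀ {c Y} → 3 * n ≡ 2 * suc c + Y → Y * Y < 5 * (n * n) → suc (d + c) >α b + n
    small-case {c} {Y} eqY Y²<5n² = small-slack (X + Y)
      (trans (slack-eq-+ {d} {suc c} {b} {n} 3b≡2d+X eqY) (cong (λ t → 2 * t + (X + Y)) (+-suc d c)))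
      ([X+Y]²<5[b+n]² Y²<5n²)

    floorα-b+n : floorα (b + n) ≡ d + floorα n
    floorα-b+n = floorα-unique (≤α-+ d≤αb (floorα-≤α n)) (by-cases (suc-floorα->α n))
      where
      by-cases : suc (floorα n) >α n → suc (d + floorα n) >α b + n
      by-cases (beyond-3/2 lt)       = beyond-case lt
      by-cases (small-slack Y eq lt) = small-case eq lt

  ones-floor-witness : ∀ {n} → 1 ≤ n → 6 * n ≤ b → occ fib 1 (a + d) n ≡ floorα n × zerosBefore (a + d) ≡ a
  ones-floor-witness {n} 1≤n 6n≤b =
    ones-fib-from-floors {n} {a + d} floorα-b (floorα-b+n 1≤n 6n≤b) ,
    +-cancelʳ-≡ d (zerosBefore (a + d)) a (zerosBefore-from-floor floorα-b)

-- Here 0 < d + 1 − b α < 2 / (√5 b), less than the fractional part of n α when n ≤ b / 6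
-- (which is positive by the irrationality of √5), so ⌊(b + n) α⌋ = d + ⌊n α⌋ + 1.
module MinusSolution {a d : ℕ} (norm : NormEq 1 0 (suc a) (suc d)) where

  b X : ℕ
  b = suc a + suc d
  X = 3 * suc a + suc d

  3b≡2[1+d]+X : 3 * b ≡ 2 * suc d + X
  3b≡2[1+d]+X = split a d
    where
    split : ∀ a d → 3 * (suc a + suc d) ≡ 2 * suc d + (3 * suc a + suc d)
    split = solve-∀

  X²+4≡5b² : X * X + 4 ≡ 5 * (b * b)
  X²+4≡5b² = +-cancelʳ-≡ (4 * (suc a * suc d + suc d * suc d + 0)) (X * X + 4) (5 * (b * b))
    (trans (identity a d) (cong (λ t → 5 * (b * b) + 4 * t) norm))
    where
    identity : ∀ a d → (3 * suc a + suc d) * (3 * suc a + suc d) + 4 + 4 * (suc a * suc d + suc d * suc d + 0) ≡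
                       5 * ((suc a + suc d) * (suc a + suc d)) + 4 * (suc a * suc a + 1)
    identity = solve-∀

  d≤αb : d ≤α b
  d≤αb = below (X + 2) (split a d) (begin
    5 * (b * b)       ≡⟨ X²+4≡5b² ⟨
    X * X + 4         ≤⟨ m≤n+m (X * X + 4) (4 * X) ⟩
    4 * X + (X * X + 4) ≡⟨ expand X ⟩
    (X + 2) * (X + 2) ∎)
    where
    open ≤-Reasoning
    split : ∀ a d → 3 * (suc a + suc d) ≡ 2 * d + (3 * suc a + suc d + 2)
    split = solve-∀
    expand : ∀ X → 4 * X + (X * X + 4) ≡ (X + 2) * (X + 2)
    expand = solve-∀

  1+d>αb : suc d >α b
  1+d>αb = small-slack X 3b≡2[1+d]+X (subst (X * X <_) X²+4≡5b² (m<m+n (X * X) (s≤s z≤n)))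

  floorα-b : floorα b ≡ d
  floorα-b = floorα-unique d≤αb 1+d>αb

  module _ {n : ℕ} (1≤n : 1 ≤ n) (6n≤b : 6 * n ≤ b) where

    Y : ℕ
    Y = _≤α_.slack (floorα-≤α n)

    5n²<Y² : 5 * (n * n) < Y * Y
    5n²<Y² = ≤∧≢⇒< (_≤α_.slack-ge (floorα-≤α n)) (λ eq → √5-irrational n {Y} 1≤n (sym eq))

    P M : ℕ
    P = X * Y
    M = 5 * b * n

    product-bound : M * M + 5 * (b * b) ≤ P * P + (20 * (n * n) + 4)
    product-bound = begin
      M * M + 5 * (b * b)                    ≡⟨ factor b n ⟩
      5 * (b * b) * (1 + 5 * (n * n))        ≡⟨ cong (_* (1 + 5 * (n * n))) X²+4≡5b² ⟨
      (X * X + 4) * (1 + 5 * (n * n))        ≡⟨ expand X n ⟩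
      X * X * (1 + 5 * (n * n)) + (20 * (n * n) + 4)
        ≤⟨ +-monoˡ-≤ (20 * (n * n) + 4) (*-monoʳ-≤ (X * X) 5n²<Y²) ⟩
      X * X * (Y * Y) + (20 * (n * n) + 4)   ≡⟨ cong (_+ (20 * (n * n) + 4)) (regroup X Y) ⟩
      P * P + (20 * (n * n) + 4)             ∎
      where
      open ≤-Reasoning
      factor : ∀ b n → 5 * b * n * (5 * b * n) + 5 * (b * b) ≡ 5 * (b * b) * (1 + 5 * (n * n))
      factor = solve-∀
      expand : ∀ X n → (X * X + 4) * (1 + 5 * (n * n)) ≡ X * X * (1 + 5 * (n * n)) + (20 * (n * n) + 4)
      expand = solve-∀
      regroup : ∀ X Y → X * X * (Y * Y) ≡ X * Y * (X * Y)
      regroup = solve-∀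

    gap : 20 * (n * n) + 4 + 2 * M + 1 < 5 * (b * b)
    gap = begin-strict
      20 * (n * n) + 4 + 2 * M + 1         ≡⟨ regroup n M ⟩
      2 * M + 20 * (n * n) + 5             <⟨ +-monoʳ-< (2 * M + 20 * (n * n)) 5<100n² ⟩
      2 * M + 20 * (n * n) + 100 * (n * n) ≡⟨ regroup′ M n ⟩
      2 * M + 20 * (6 * n * n)             ≤⟨ +-monoʳ-≤ (2 * M) (*-monoʳ-≤ 20 (*-monoˡ-≤ n 6n≤b)) ⟩
      2 * M + 20 * (b * n)                 ≡⟨ regroup″ b n ⟩
      5 * (b * (6 * n))                    ≤⟨ *-monoʳ-≤ 5 (*-monoʳ-≤ b 6n≤b) ⟩
      5 * (b * b)                          ∎
      where
      open ≤-Reasoning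
      5<100n² : 5 < 100 * (n * n)
      5<100n² = ≤-trans (s≤s (s≤s (s≤s (s≤s (s≤s (s≤s z≤n)))))) (*-monoʳ-≤ 100 (*-mono-≤ 1≤n 1≤n))
      regroup : ∀ n M → 20 * (n * n) + 4 + 2 * M + 1 ≡ 2 * M + 20 * (n * n) + 5
      regroup = solve-∀
      regroup′ : ∀ M n → 2 * M + 20 * (n * n) + 100 * (n * n) ≡ 2 * M + 20 * (6 * n * n)
      regroup′ = solve-∀
      regroup″ : ∀ b n → 2 * (5 * b * n) + 20 * (b * n) ≡ 5 * (b * (6 * n))
      regroup″ = solve-∀

    sum≤α : d + suc (floorα n) ≤α b + n
    sum≤α = below (X + Y)
      (trans (slack-eq-+ {suc d} {floorα n} {b} {n} 3b≡2[1+d]+X (_≤α_.slack-eq (floorα-≤α n)))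
             (cong (λ t → 2 * t + (X + Y)) (sym (+-suc d (floorα n)))))
      (begin
        5 * ((b + n) * (b + n))                ≡⟨ expand b n ⟩
        5 * (b * b) + 2 * M + 5 * (n * n)      ≡⟨ cong (λ t → t + 2 * M + 5 * (n * n)) X²+4≡5b² ⟨
        X * X + 4 + 2 * M + 5 * (n * n)        ≡⟨ regroup X M n ⟩
        X * X + 2 * (2 + M) + 5 * (n * n)
          ≤⟨ +-mono-≤ (+-monoʳ-≤ (X * X) (*-monoʳ-≤ 2 (square-gap⇒2+≤ {M} {P} product-bound gap))) (<⇒≤ 5n²<Y²) ⟩
        X * X + 2 * P + Y * Y                  ≡⟨ expand′ X Y ⟩
        (X + Y) * (X + Y)                      ∎)
      where
      open ≤-Reasoning
      expand : ∀ b n → 5 * ((b + n) * (b + n)) ≡ 5 * (b * b) + 2 * (5 * b * n) + 5 * (n * n)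
      expand = solve-∀
      regroup : ∀ X M n → X * X + 4 + 2 * M + 5 * (n * n) ≡ X * X + 2 * (2 + M) + 5 * (n * n)
      regroup = solve-∀
      expand′ : ∀ X Y → X * X + 2 * (X * Y) + Y * Y ≡ (X + Y) * (X + Y)
      expand′ = solve-∀

    floorα-b+n : floorα (b + n) ≡ d + suc (floorα n)
    floorα-b+n = floorα-unique sum≤α (>α-+ 1+d>αb (suc-floorα->α n))

  ones-floor+1-witness : ∀ {n} → 1 ≤ n → 6 * n ≤ b →
                         occ fib 1 (a + suc d) n ≡ suc (floorα n) × zerosBefore (a + suc d) ≡ suc a
  ones-floor+1-witness {n} 1≤n 6n≤b =
    ones-fib-from-floors {n} {a + suc d} floorα-b (floorα-b+n 1≤n 6n≤b) ,
    +-cancelʳ-≡ d (zerosBefore (a + suc d)) (suc a)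
      (trans (zerosBefore-from-floor floorα-b) (+-suc a d))

normEq-step : ∀ {s t a d} → NormEq s t a d → NormEq s t (13 * a + 8 * d) (8 * a + 5 * d)
normEq-step {s} {t} {a} {d} norm =
  trans (split s a d) (trans (cong (λ u → 168 * (a * a) + 208 * (a * d) + 64 * (d * d) + u) norm) (merge t a d))
  where
  split : ∀ s a d → (13 * a + 8 * d) * (13 * a + 8 * d) + s ≡
                    168 * (a * a) + 208 * (a * d) + 64 * (d * d) + (a * a + s)
  split = solve-∀
  merge : ∀ t a d → 168 * (a * a) + 208 * (a * d) + 64 * (d * d) + (a * d + d * d + t) ≡
                    (13 * a + 8 * d) * (8 * a + 5 * d) + (8 * a + 5 * d) * (8 * a + 5 * d) + t
  merge = solve-∀

-- The solution is (1 + a, d); the factor of t it yields starts at position a + d.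
record LargeSolution (s t : ℕ) (e : Bool) (N : ℕ) : Set where
  constructor solution
  field
    a d      : ℕ
    norm     : NormEq s t (suc a) d
    a-parity : isEven a ≡ e
    large    : N ≤ suc a + d

isEven-2*+ : ∀ y x → isEven (2 * y + x) ≡ isEven x
isEven-2*+ zero    x = refl
isEven-2*+ (suc y) x = trans (cong isEven (regroup y x)) (isEven-2*+ y x)
  where
  regroup : ∀ y x → 2 * suc y + x ≡ suc (suc (2 * y + x))
  regroup = solve-∀

-- (a, d) ↦ (13 a + 8 d, 8 a + 5 d) multiplies a − d φ by the unit (1 − φ)⁶ = 13 − 8 φ of norm 1;
-- the new first component 1 + (a + 12 (1 + a) + 8 d) is 13 (1 + a) + 8 d by computation.
solution-step : ∀ {s t e N} → LargeSolution s t e N → LargeSolution s t e (suc N)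
solution-step {s} {t} (solution a d norm a-parity large) =
  solution (a + 12 * suc a + 8 * d) (8 * suc a + 5 * d) (normEq-step {s} {t} {suc a} {d} norm)
           (trans (cong isEven (regroup a d)) (trans (isEven-2*+ (6 * suc a + 4 * d) a) a-parity))
           (≤-trans (s≤s large) (subst (suc (suc a + d) ≤_) (regroup′ a d) (m≤m+n _ (19 + 20 * a + 12 * d))))
  where
  regroup : ∀ a d → a + 12 * suc a + 8 * d ≡ 2 * (6 * suc a + 4 * d) + a
  regroup = solve-∀
  regroup′ : ∀ a d → suc (suc a + d) + (19 + 20 * a + 12 * d) ≡ suc (a + 12 * suc a + 8 * d) + (8 * suc a + 5 * d)
  regroup′ = solve-∀

large-solution : ∀ {s t e} → LargeSolution s t e 0 → ∀ N → LargeSolution s t e N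
large-solution seed zero    = seed
large-solution seed (suc N) = solution-step (large-solution seed N)

Witness : ℕ → ℕ → Bool → Set
Witness n o e = ∃[ i ] occ fib 1 i n ≡ o × isEven (zerosBefore i) ≡ e

floor-witness : ∀ {n} → 1 ≤ n → ∀ e → Witness n (floorα n) e
floor-witness {n} 1≤n e = from-solution (large-solution (seed e) (6 * n))
  where
  seed : ∀ e → LargeSolution 0 1 e 0
  seed true  = solution 0 0 refl refl z≤n
  seed false = solution 1 1 refl refl z≤n
  from-solution : LargeSolution 0 1 e (6 * n) → Witness n (floorα n) e
  from-solution (solution a d norm a-parity large) = a + d , proj₁ w , trans (cong isEven (proj₂ w)) a-parity
    where
    w : occ fib 1 (a + d) n ≡ floorα n × zerosBefore (a + d) ≡ a
    w = PlusSolution.ones-floor-witness norm 1≤n large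

floor+1-witness : ∀ {n} → 1 ≤ n → ∀ e → Witness n (suc (floorα n)) e
floor+1-witness {n} 1≤n e = from-solution (large-solution (seed e) (6 * n))
  where
  seed : ∀ e → LargeSolution 1 0 (not e) 0
  seed true  = solution 7 5 refl refl z≤n
  seed false = solution 0 1 refl refl z≤n
  from-solution : LargeSolution 1 0 (not e) (6 * n) → Witness n (suc (floorα n)) e
  from-solution (solution a zero norm _ _) =
    ⊥-elim (1+n≢0 (trans norm (cong (λ z → z + 0 * 0 + 0) (*-zeroʳ (suc a)))))
  from-solution (solution a (suc d) norm a-parity large) =
    a + suc d , proj₁ w ,
    trans (cong isEven (proj₂ w)) (trans (isEven-suc a) (trans (cong not a-parity) (not-involutive e)))
    where
    w : occ fib 1 (a + suc d) n ≡ suc (floorα n) × zerosBefore (a + suc d) ≡ suc a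
    w = MinusSolution.ones-floor+1-witness norm 1≤n large

-- Abelian complexity

HasThreeValues : {A : Set} → (ℕ → A) → Set
HasThreeValues f = ∃[ u ] ∃[ v ] ∃[ w ]
  ((u ≢ v) × (u ≢ w) × (v ≢ w)
  × (∃[ i ] f i ≡ u) × (∃[ i ] f i ≡ v) × (∃[ i ] f i ≡ w)
  × ((i : ℕ) → (f i ≡ u) ⊎ (f i ≡ v) ⊎ (f i ≡ w)))

three-values : ∀ {A : Set} (f : ℕ → A) (V : ℕ → Bool → A) c →
  (∀ e e′ → V c e ≢ V (suc c) e′) →
  (∀ e → ∃[ i ] f i ≡ V c e) → (∀ e → ∃[ i ] f i ≡ V (suc c) e) →
  (∀ i → ∃[ e ] (f i ≡ V c e ⊎ f i ≡ V (suc c) e)) →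
  (V c true ≡ V c false × V (suc c) true ≢ V (suc c) false) ⊎
  (V c true ≢ V c false × V (suc c) true ≡ V (suc c) false) →
  HasThreeValues f
three-values f V c apart at-c at-1+c cover (inj₁ (same , differ)) =
  V c true , V (suc c) true , V (suc c) false ,
  apart true true , apart true false , differ ,
  at-c true , at-1+c true , at-1+c false , classify
  where
  classify : ∀ i → (f i ≡ V c true) ⊎ (f i ≡ V (suc c) true) ⊎ (f i ≡ V (suc c) false)
  classify i with cover i
  ... | true  , inj₁ eq = inj₁ eq
  ... | false , inj₁ eq = inj₁ (trans eq (sym same))
  ... | true  , inj₂ eq = inj₂ (inj₁ eq)
  ... | false , inj₂ eq = inj₂ (inj₂ eq)
three-values f V c apart at-c at-1+c cover (inj₂ (differ , same)) =
  V c true , V c false , V (suc c) true ,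
  differ , apart true true , apart false true ,
  at-c true , at-c false , at-1+c true , classify
  where
  classify : ∀ i → (f i ≡ V c true) ⊎ (f i ≡ V c false) ⊎ (f i ≡ V (suc c) true)
  classify i with cover i
  ... | true  , inj₁ eq = inj₁ eq
  ... | false , inj₁ eq = inj₂ (inj₁ eq)
  ... | true  , inj₂ eq = inj₂ (inj₂ eq)
  ... | false , inj₂ eq = inj₂ (inj₂ (trans eq (sym same)))

isEven-∸-alternates : ∀ {c n} → c < n → isEven (n ∸ c) ≡ not (isEven (n ∸ suc c))
isEven-∸-alternates {c} {n} c<n = trans (cong isEven (m<n⇒n∸m≡1+[n∸1+m] c<n)) (isEven-suc (n ∸ suc c))

exactly-one-collapses : ∀ {c n} → c < n →
  (parikhT true c (n ∸ c) ≡ parikhT false c (n ∸ c) × parikhT true (suc c) (n ∸ suc c) ≢ parikhT false (suc c) (n ∸ suc c)) ⊎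
  (parikhT true c (n ∸ c) ≢ parikhT false c (n ∸ c) × parikhT true (suc c) (n ∸ suc c) ≡ parikhT false (suc c) (n ∸ suc c))
exactly-one-collapses {c} {n} c<n with isEven (n ∸ suc c) in eq
... | true  = inj₂ (parikhT-split c (n ∸ c) (trans (isEven-∸-alternates c<n) (cong not eq)) ,
                    parikhT-collapse (suc c) (n ∸ suc c) eq)
... | false = inj₁ (parikhT-collapse c (n ∸ c) (trans (isEven-∸-alternates c<n) (cong not eq)) ,
                    parikhT-split (suc c) (n ∸ suc c) eq)

witness-value : ∀ {n o e} → Witness n o e → ∃[ i ] parikh tw i n ≡ parikhT e o (n ∸ o)
witness-value {n} (i , ones , parity) =
  i , trans (parikh-tw n i) (cong₂ (λ o e → parikhT e o (n ∸ o)) ones parity)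

parikh-tw-values : ∀ n i → ∃[ e ] (parikh tw i n ≡ parikhT e (floorα n) (n ∸ floorα n)
                                  ⊎ parikh tw i n ≡ parikhT e (suc (floorα n)) (n ∸ suc (floorα n)))
parikh-tw-values n i = isEven (zerosBefore i) , by-ones (ones-fib-window n i)
  where
  value : ∀ {o} → occ fib 1 i n ≡ o → parikh tw i n ≡ parikhT (isEven (zerosBefore i)) o (n ∸ o)
  value eq = trans (parikh-tw n i) (cong (λ o → parikhT (isEven (zerosBefore i)) o (n ∸ o)) eq)
  by-ones : occ fib 1 i n ≡ floorα n ⊎ occ fib 1 i n ≡ suc (floorα n) →
            parikh tw i n ≡ parikhT (isEven (zerosBefore i)) (floorα n) (n ∸ floorα n)
            ⊎ parikh tw i n ≡ parikhT (isEven (zerosBefore i)) (suc (floorα n)) (n ∸ suc (floorα n))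
  by-ones (inj₁ eq) = inj₁ (value eq)
  by-ones (inj₂ eq) = inj₂ (value eq)

lemma11 : (n : ℕ) → 1 ≤ n →
    ∃[ u ] ∃[ v ] ∃[ w ]
      ((u ≢ v) × (u ≢ w) × (v ≢ w)
      × (∃[ i ] parikh tw i n ≡ u) × (∃[ i ] parikh tw i n ≡ v) × (∃[ i ] parikh tw i n ≡ w)
      × ((i : ℕ) → (parikh tw i n ≡ u) ⊎ (parikh tw i n ≡ v) ⊎ (parikh tw i n ≡ w)))
lemma11 n 1≤n =
  three-values (λ i → parikh tw i n) V c (λ e e′ → parikhT-≢-suc e e′ c (n ∸ c) (n ∸ suc c))
    (λ e → witness-value {n} (floor-witness 1≤n e)) (λ e → witness-value {n} (floor+1-witness 1≤n e))
    (parikh-tw-values n) (exactly-one-collapses c<n)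
  where
  c : ℕ
  c = floorα n
  V : ℕ → Bool → ℕ × ℕ × ℕ
  V o e = parikhT e o (n ∸ o)
  c<n : c < n
  c<n = >α⇒floorα< (≥⇒>α 1≤n ≤-refl)
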